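{- Every nontrivial deficiency-critical graph $G$ contains a vertex $x$ and two distinct vertices $y,z$ such that $N(y)=N(z)=\{x\}$.
   Context: All graphs are finite and simple. The deficiency $\operatorname{def}(G)$ is the number of vertices not saturated by a maximum matching. A connected graph $G$ is deficiency-critical if $\operatorname{def}(G')<\operatorname{def}(G)$ for every proper connected induced subgraph $G'$ of $G$; it is nontrivial if $|V(G)|\ge2$. (A vertex $x$ with two such pendent neighbours $y,z$ is called a snail horn.) -}

module Defs where

open import Data.Nat using (ℕ; _≤_; _<_)
open import Data.Bool using (Bool; true; false; _∧_)
open import Data.Fin using (Fin)
open import Data.Fin.Subset using (Subset; _∈_; _⊂_; ⊤; ∣_∣; Nonempty)
open import Data.Maybe using (Maybe; just; nothing; is-nothing)
open import Data.Vec using (tabulate; lookup)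
open import Data.Product using (Σ; _×_; ∃; ∃-syntax; _,_)
open import Relation.Binary.PropositionalEquality using (_≡_; _≢_)
open import Relation.Nullary using (¬_)
open import Function.Bundles using (_⇔_)

record Graph (n : ℕ) : Set where
  field
    adj     : Fin n → Fin n → Bool
    sym     : ∀ x y → adj x y ≡ adj y x
    irrefl  : ∀ x → adj x x ≡ false
open Graph public

module _ {n : ℕ} (G : Graph n) where

  Adj : Fin n → Fin n → Set
  Adj x y = adj G x y ≡ true

  data Walk (S : Subset n) : Fin n → Fin n → Set where
    here : ∀ {x} → x ∈ S → Walk S x x
    step : ∀ {x y z} → x ∈ S → Adj x y → Walk S y z → Walk S x z

  Connected : Subset n → Set
  Connected S = Nonempty S × (∀ x y → x ∈ S → y ∈ S → Walk S x y)

  -- A matching of G[S], given by a partner function: m x = just y means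
  -- the edge xy is in the matching; m x = nothing means x is unsaturated.
  IsMatching : Subset n → (Fin n → Maybe (Fin n)) → Set
  IsMatching S m = ∀ x y → m x ≡ just y →
    x ∈ S × y ∈ S × Adj x y × m y ≡ just x

  unsat : Subset n → (Fin n → Maybe (Fin n)) → ℕ
  unsat S m = ∣ tabulate (λ x → lookup S x ∧ is-nothing (m x)) ∣

  Deficiency : Subset n → ℕ → Set
  Deficiency S d =
    (∃[ m ] (IsMatching S m × unsat S m ≡ d)) ×
    (∀ m → IsMatching S m → d ≤ unsat S m)

  DeficiencyCritical : Set
  DeficiencyCritical =
    Connected ⊤ ×
    (∀ S → S ⊂ ⊤ → Connected S →
       ∀ d d′ → Deficiency S d → Deficiency ⊤ d′ → d < d′)

  NbhdIsSingleton : Fin n → Fin n → Set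
  NbhdIsSingleton y x = ∀ w → Adj y w ⇔ (w ≡ x)

{-# OPTIONS --safe #-}
-- For an edge ab of a deficiency-critical graph G, the graph G − a − b is nonempty and
-- disconnected: a maximum matching of G − a − b together with ab gives
-- def G ≤ def (G − a − b), contradicting criticality if G − a − b is connected; if it is
-- empty then def G = 0, although criticality gives def G > def G[{a}] ≥ 0.
--
-- Call K a pocket at {a, b} (a = b, or ab an edge) if all neighbours of K lie in K ∪ {a, b}.
-- If ye is an edge inside a pocket K, the side of G − y − e not containing {a, b} is a pocket
-- at {y, e} strictly inside K; hence every pocket contains a vertex with at most two
-- neighbours.  Such a vertex yields a pocket with at least two vertices at a single vertex v,
-- and a minimal one consists of two pendant vertices at v, since otherwise its low-degree
-- vertex yields a smaller one.  Maximum matchings and reachability are only available under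
-- double negation, which suffices because having a snail horn is decidable.

module Submission where

open import Defs hiding (sym)
open import Level using (0ℓ)
open import Data.Nat using (ℕ; zero; suc; _≤_; _<_; z≤n; s≤s)
open import Data.Nat.Properties using (≮⇒≥; <⇒≱; n≮0; module ≤-Reasoning)
open import Data.Nat.Induction using (<-rec)
open import Data.Bool using (true; false; _∧_)
open import Data.Bool.Properties using (∧-zeroʳ; ∧-identityʳ; ¬-not) renaming (_≟_ to _≟ᵇ_)
open import Data.Fin using (Fin; zero; suc; _≟_)
open import Data.Fin.Properties using (any?; all?)
open import Data.Fin.Subset using (Subset; _∈_; _∉_; _⊆_; _⊂_; ⊤; ⁅_⁆; _∪_; _-_; ∣_∣; Nonempty)
open import Data.Fin.Subset.Properties
  using (_∈?_; nonempty?; Empty-unique; ∣⊥∣≡0; ∈⊤; ⊆⊤; x∈⁅x⁆; x∈⁅y⁆⇒x≡y; x≢y⇒x∉⁅y⁆;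
         x∈p∪q⁺; x∈p∪q⁻; p─q⊆p; x∈p∧x≢y⇒x∈p-y; x∈p⇒p-x⊂p)
open import Data.Fin.Subset.Induction using (⊂-wellFounded; Acc; acc)
open import Data.Maybe using (Maybe; just; nothing; is-nothing)
open import Data.Maybe.Properties using (just-injective)
open import Data.Vec using (_∷_; there; tabulate; lookup)
open import Data.Vec.Properties
  using ([]=⇒lookup; lookup⇒[]=; lookup∘tabulate; tabulate∘lookup; tabulate-cong)
open import Data.Product using (Σ; ∃; ∃₂; ∃-syntax; _×_; _,_; proj₁; proj₂)
open import Data.Sum using (_⊎_; inj₁; inj₂; [_,_]; reduce)
import Data.Sum as Sum
open import Data.Empty using (⊥-elim)
open import Function using (_∘_; id)
open import Function.Bundles using (mk⇔; Equivalence)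
open import Relation.Binary.PropositionalEquality
  using (_≡_; _≢_; refl; trans; subst; cong) renaming (sym to ≡-sym)
open import Relation.Nullary using (¬_; Dec; yes; no; does; proof)
open import Relation.Nullary.Reflects using (Reflects; invert)
open import Relation.Nullary.Decidable
  using (¬?; _×-dec_; _→-dec_; map′; decidable-stable; dec-true; toSum; ¬¬-excluded-middle)
open import Relation.Nullary.Negation using (¬¬-Monad; contradiction)
open import Relation.Unary using (Decidable)
open import Effect.Monad using (RawMonad)

open RawMonad (¬¬-Monad {0ℓ}) using (pure; _>>=_; _<$>_)

private variable
  n : ℕ

¬¬-∀-Fin : {P : Fin n → Set} → (∀ i → ¬ ¬ P i) → ¬ ¬ (∀ i → P i)
¬¬-∀-Fin {zero}  _ k = k λ ()
¬¬-∀-Fin {suc n} h k =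
  h zero λ p₀ → ¬¬-∀-Fin (h ∘ suc) λ ps → k λ { zero → p₀ ; (suc i) → ps i }

¬¬-decidable : (P : Fin n → Set) → ¬ ¬ Decidable P
¬¬-decidable P = ¬¬-∀-Fin λ _ → ¬¬-excluded-middle

¬¬-least : {P : ℕ → Set} {i : ℕ} → P i → ¬ ¬ (∃ λ j → P j × ∀ {k} → P k → j ≤ k)
¬¬-least {P = P} {i} pᵢ ¬least = <-rec (λ i → ¬ P i) not-least i pᵢ
  where
  not-least : ∀ i → (∀ {j} → j < i → ¬ P j) → ¬ P i
  not-least i below pᵢ = ¬least (i , pᵢ , λ pₖ → ≮⇒≥ λ k<i → below k<i pₖ)

decSubset : {P : Fin n → Set} → Decidable P → Subset n
decSubset P? = tabulate (does ∘ P?)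

module _ {P : Fin n → Set} (P? : Decidable P) where

  ∈-decSubset⁺ : ∀ {x} → P x → x ∈ decSubset P?
  ∈-decSubset⁺ {x} px = lookup⇒[]= x _ (trans (lookup∘tabulate _ x) (dec-true (P? x) px))

  ∈-decSubset⁻ : ∀ {x} → x ∈ decSubset P? → P x
  ∈-decSubset⁻ {x} x∈ = invert (subst (Reflects (P x)) does≡true (proof (P? x)))
    where
    does≡true = trans (≡-sym (lookup∘tabulate _ x)) ([]=⇒lookup x∈)

y∉p-y : (p : Subset n) (y : Fin n) → y ∉ p - y
y∉p-y (_ ∷ p) (suc y) (there y∈) = y∉p-y p y y∈

x∈p-y⇒x≢y : {p : Subset n} {x y : Fin n} → x ∈ p - y → x ≢ y
x∈p-y⇒x≢y {p = p} {x} x∈ refl = y∉p-y p x x∈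

∉⇒≢ : {p : Subset n} {x y : Fin n} → x ∉ p → y ∈ p → x ≢ y
∉⇒≢ x∉ y∈ refl = x∉ y∈

∈⊤-y-z⁺ : {x y z : Fin n} → x ≢ y → x ≢ z → x ∈ ⊤ - y - z
∈⊤-y-z⁺ x≢y x≢z = x∈p∧x≢y⇒x∈p-y (x∈p∧x≢y⇒x∈p-y ∈⊤ x≢y) x≢z

∈⊤-y-z⁻ : {x y z : Fin n} → x ∈ ⊤ - y - z → x ≢ y × x ≢ z
∈⊤-y-z⁻ x∈ = x∈p-y⇒x≢y (p─q⊆p _ _ x∈) , x∈p-y⇒x≢y x∈

∉⇒∈⊤-y-z : {p : Subset n} {x y z : Fin n} → x ∉ p → y ∈ p → z ∈ p → x ∈ ⊤ - y - z
∉⇒∈⊤-y-z x∉ y∈ z∈ = ∈⊤-y-z⁺ (∉⇒≢ x∉ y∈) (∉⇒≢ x∉ z∈)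

lookup-∉ : {p : Subset n} {x : Fin n} → x ∉ p → lookup p x ≡ false
lookup-∉ {p = p} {x} x∉ = ¬-not (x∉ ∘ lookup⇒[]= x p)

module _ {n : ℕ} (G : Graph n) where

  private variable
    a b c e v w x y z : Fin n
    K L S : Subset n

  Adj-sym : Adj G x y → Adj G y x
  Adj-sym {x} {y} xy = trans (Graph.sym G y x) xy

  Adj⇒≢ : Adj G x y → x ≢ y
  Adj⇒≢ {x} xx refl = contradiction (trans (≡-sym xx) (irrefl G x)) λ ()

  Adj? : ∀ x y → Dec (Adj G x y)
  Adj? x y = adj G x y ≟ᵇ true

  walk-end : Walk G S x y → y ∈ S
  walk-end (here y∈S)      = y∈S
  walk-end (step _ _ walk) = walk-end walk

  walk-snoc : Walk G S x y → Adj G y z → z ∈ S → Walk G S x z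
  walk-snoc (here y∈S)          yz z∈S = step y∈S yz (here z∈S)
  walk-snoc (step x∈S xw walk) yz z∈S = step x∈S xw (walk-snoc walk yz z∈S)

  walk-preserves : (X : Fin n → Set) → (∀ {x w} → X x → Adj G x w → X w) →
                   Walk G S x y → X x → X y
  walk-preserves X stays (here _)         x∈X = x∈X
  walk-preserves X stays (step _ xw walk) x∈X = walk-preserves X stays walk (stays x∈X xw)

  first-edge : Walk G S x y → x ≢ y → ∃ (Adj G x)
  first-edge (here _)      x≢x = contradiction refl x≢x
  first-edge (step _ xw _) _   = _ , xw

  NbhdWithin : Fin n → (Fin n → Set) → Set
  NbhdWithin y P = ∀ {w} → Adj G y w → P w

  pivot : NbhdWithin y (λ w → w ≡ a ⊎ w ≡ b) → Adj G y c →
          ∃ λ d → NbhdWithin y (λ w → w ≡ c ⊎ w ≡ d)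
  pivot {a = a} {b} N⊆ yc with N⊆ yc
  ... | inj₁ refl = b , N⊆
  ... | inj₂ refl = a , λ yw → Sum.swap (N⊆ yw)

  nbhd-toward : NbhdWithin y (λ w → w ≡ a ⊎ w ≡ b) → b ∈ K → NbhdWithin y (λ w → w ≡ a ⊎ w ∈ K)
  nbhd-toward N⊆ b∈K yw = Sum.map₂ (λ { refl → b∈K }) (N⊆ yw)

  SnailHorn : Set
  SnailHorn = ∃[ x ] ∃[ y ] ∃[ z ] (y ≢ z × NbhdIsSingleton G y x × NbhdIsSingleton G z x)

  snail-horn? : Dec SnailHorn
  snail-horn? = any? λ x → any? λ y → any? λ z →
    ¬? (y ≟ z) ×-dec singleton? y x ×-dec singleton? z x
    where
    singleton? : ∀ y x → Dec (NbhdIsSingleton G y x)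
    singleton? y x = all? λ w →
      map′ (λ (to , from) → mk⇔ to from) (λ e → Equivalence.to e , Equivalence.from e)
           ((Adj? y w →-dec w ≟ x) ×-dec (w ≟ x →-dec Adj? y w))

  Matching : Set
  Matching = Fin n → Maybe (Fin n)

  deficiency-exists : ∀ S → ¬ ¬ ∃ (Deficiency G S)
  deficiency-exists S = minimum <$> ¬¬-least ((λ _ → nothing) , (λ _ _ ()) , refl)
    where
    minimum : (∃ λ d → (∃[ m ] (IsMatching G S m × unsat G S m ≡ d)) ×
                         ∀ {k} → ∃[ m ] (IsMatching G S m × unsat G S m ≡ k) → d ≤ k) →
              ∃ (Deficiency G S)
    minimum (d , achieved , least) = d , achieved , λ m m-matching → least (m , m-matching , refl)

  unsat-nothing : unsat G S (λ _ → nothing) ≡ ∣ S ∣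
  unsat-nothing {S} =
    cong ∣_∣ (trans (tabulate-cong (λ x → ∧-identityʳ (lookup S x))) (tabulate∘lookup S))

  extend : Fin n → Fin n → Matching → Matching
  extend a b m x with x ≟ a | x ≟ b
  ... | yes _ | _     = just b
  ... | no _  | yes _ = just a
  ... | no _  | no _  = m x

  module _ {m : Matching} where

    extend-a : extend a b m a ≡ just b
    extend-a {a} with a ≟ a
    ... | yes _   = refl
    ... | no a≢a = contradiction refl a≢a

    extend-b : Adj G a b → extend a b m b ≡ just a
    extend-b {a} {b} ab with b ≟ a | b ≟ b
    ... | yes b≡a | _      = contradiction (≡-sym b≡a) (Adj⇒≢ ab)
    ... | no _    | yes _   = refl
    ... | no _    | no b≢b = contradiction refl b≢b

    extend-other : x ≢ a → x ≢ b → extend a b m x ≡ m x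
    extend-other {x} {a} {b} x≢a x≢b with x ≟ a | x ≟ b
    ... | yes x≡a | _      = contradiction x≡a x≢a
    ... | no _    | yes x≡b = contradiction x≡b x≢b
    ... | no _    | no _    = refl

    extend-isMatching : Adj G a b → IsMatching G (⊤ - a - b) m → IsMatching G ⊤ (extend a b m)
    extend-isMatching {a} {b} ab m-matching x y mx≡y with x ≟ a | x ≟ b
    ... | yes refl | _ with refl ← just-injective mx≡y = ∈⊤ , ∈⊤ , ab , extend-b ab
    ... | no _ | yes refl with refl ← just-injective mx≡y =
      ∈⊤ , ∈⊤ , Adj-sym ab , extend-a {a = a} {b = x}
    ... | no _ | no _ with m-matching x y mx≡y
    ...   | _ , y∈ , xy , my≡x = ∈⊤ , ∈⊤ , xy , trans (extend-other y≢a y≢b) my≡x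
      where
      y≢a = proj₁ (∈⊤-y-z⁻ y∈)
      y≢b = proj₂ (∈⊤-y-z⁻ y∈)

    unsat-extend : unsat G ⊤ (extend a b m) ≡ unsat G (⊤ - a - b) m
    unsat-extend {a} {b} = cong ∣_∣ (tabulate-cong pointwise)
      where
      deleted : ∀ x → x ∉ ⊤ - a - b →
                lookup ⊤ x ∧ false ≡ lookup (⊤ - a - b) x ∧ is-nothing (m x)
      deleted x x∉ = trans (∧-zeroʳ _) (≡-sym (cong (_∧ is-nothing (m x)) (lookup-∉ x∉)))

      pointwise : ∀ x → lookup ⊤ x ∧ is-nothing (extend a b m x) ≡
                        lookup (⊤ - a - b) x ∧ is-nothing (m x)
      pointwise x with x ≟ a | x ≟ b
      ... | yes refl | _      = deleted x λ x∈ → proj₁ (∈⊤-y-z⁻ x∈) refl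
      ... | no _     | yes refl = deleted x λ x∈ → proj₂ (∈⊤-y-z⁻ x∈) refl
      ... | no x≢a   | no x≢b  =
        cong (_∧ is-nothing (m x))
             (trans ([]=⇒lookup (∈⊤ {x = x})) (≡-sym ([]=⇒lookup (∈⊤-y-z⁺ x≢a x≢b))))

  deficiency-≤-deletion : ∀ {d d′} → Adj G a b →
                          Deficiency G ⊤ d → Deficiency G (⊤ - a - b) d′ → d ≤ d′
  deficiency-≤-deletion {a} {b} ab (_ , least) ((m , m-matching , refl) , _) =
    subst (_ ≤_) unsat-extend (least (extend a b m) (extend-isMatching ab m-matching))

  ⁅⁆-connected : ∀ a → Connected G ⁅ a ⁆
  ⁅⁆-connected a = (a , x∈⁅x⁆ a) , connect
    where
    connect : ∀ x y → x ∈ ⁅ a ⁆ → y ∈ ⁅ a ⁆ → Walk G ⁅ a ⁆ x y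
    connect x y x∈ y∈ with refl ← x∈⁅y⁆⇒x≡y a x∈ | refl ← x∈⁅y⁆⇒x≡y a y∈ = here x∈

  critical⇒deletion-disconnected : DeficiencyCritical G → Adj G a b → ¬ Connected G (⊤ - a - b)
  critical⇒deletion-disconnected {a} {b} (_ , critical) ab connected =
    deficiency-exists ⊤ λ (d , def) →
    deficiency-exists (⊤ - a - b) λ (d′ , def′) →
    <⇒≱ (critical _ (⊆⊤ , a , ∈⊤ , λ a∈ → proj₁ (∈⊤-y-z⁻ a∈) refl) connected d′ d def′ def)
        (deficiency-≤-deletion ab def def′)

  critical⇒deletion-nonempty : DeficiencyCritical G → Adj G a b → Nonempty (⊤ - a - b)
  critical⇒deletion-nonempty {a} {b} (_ , critical) ab = decidable-stable (nonempty? _) λ empty →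
    deficiency-exists ⊤ λ (d , def) →
    deficiency-exists (⊤ - a - b) λ (d′ , def′) →
    deficiency-exists ⁅ a ⁆ λ (d₁ , def₁) →
    n≮0 (begin-strict
      d₁                                   <⟨ critical ⁅ a ⁆ ⁅a⁆⊂⊤ (⁅⁆-connected a) d₁ d def₁ def ⟩
      d                                    ≤⟨ deficiency-≤-deletion ab def def′ ⟩
      d′                                   ≤⟨ proj₂ def′ (λ _ → nothing) (λ _ _ ()) ⟩
      unsat G (⊤ - a - b) (λ _ → nothing)  ≡⟨ unsat-nothing {S = ⊤ - a - b} ⟩
      ∣ ⊤ - a - b ∣                         ≡⟨ trans (cong ∣_∣ (Empty-unique empty)) (∣⊥∣≡0 n) ⟩
      0                                    ∎)
    where
    open ≤-Reasoning
    ⁅a⁆⊂⊤ : ⁅ a ⁆ ⊂ ⊤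
    ⁅a⁆⊂⊤ = ⊆⊤ , b , ∈⊤ , x≢y⇒x∉⁅y⁆ (Adj⇒≢ ab ∘ ≡-sym)

  record Separation (S : Subset n) : Set where
    field
      A B        : Subset n
      A⊆S        : A ⊆ S
      B⊆S        : B ⊆ S
      cover      : ∀ {w} → w ∈ S → w ∈ A ⊎ w ∈ B
      disjoint   : ∀ {w} → w ∈ A → w ∉ B
      no-edge    : ∀ {x w} → x ∈ A → w ∈ B → ¬ Adj G x w
      A-nonempty : Nonempty A
      B-nonempty : Nonempty B
  open Separation

  swap : Separation S → Separation S
  swap s = record
    { A = B s ; B = A s ; A⊆S = B⊆S s ; B⊆S = A⊆S s
    ; cover = λ w∈S → Sum.swap (cover s w∈S)
    ; disjoint = λ w∈B w∈A → disjoint s w∈A w∈B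
    ; no-edge = λ x∈B w∈A xw → no-edge s w∈A x∈B (Adj-sym xw)
    ; A-nonempty = B-nonempty s ; B-nonempty = A-nonempty s
    }

  orient : (s : Separation S) → w ∈ S → Σ (Separation S) λ s′ → w ∈ A s′
  orient s w∈S with cover s w∈S
  ... | inj₁ w∈A = s , w∈A
  ... | inj₂ w∈B = swap s , w∈B

  adjacent-same-side : (s : Separation S) → Adj G x w → x ∈ A s → w ∈ S → w ∈ A s
  adjacent-same-side s xw x∈A w∈S =
    [ id , (λ w∈B → contradiction xw (no-edge s x∈A w∈B)) ] (cover s w∈S)

  ¬connected⇒separation : Nonempty S → ¬ Connected G S → ¬ ¬ Separation S
  ¬connected⇒separation {S} nonempty disconnected =
    split <$> ¬¬-∀-Fin λ x → ¬¬-decidable (Walk G S x)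
    where
    reachability : ∀ {x y} → Decidable (Walk G S x) → x ∈ S → y ∈ S → ¬ Walk G S x y → Separation S
    reachability {x} walk? x∈S y∈S x↛y = record
      { A = decSubset walk?
      ; B = decSubset unreached?
      ; A⊆S = λ w∈A → walk-end (∈-decSubset⁻ walk? w∈A)
      ; B⊆S = λ w∈B → proj₁ (∈-decSubset⁻ unreached? w∈B)
      ; cover = λ w∈S → Sum.map (∈-decSubset⁺ walk?) (λ x↛w → ∈-decSubset⁺ unreached? (w∈S , x↛w))
                                (toSum (walk? _))
      ; disjoint = λ w∈A w∈B → proj₂ (∈-decSubset⁻ unreached? w∈B) (∈-decSubset⁻ walk? w∈A)
      ; no-edge = λ u∈A w∈B uw → let (w∈S , x↛w) = ∈-decSubset⁻ unreached? w∈B in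
                                 x↛w (walk-snoc (∈-decSubset⁻ walk? u∈A) uw w∈S)
      ; A-nonempty = x , ∈-decSubset⁺ walk? (here x∈S)
      ; B-nonempty = _ , ∈-decSubset⁺ unreached? (y∈S , x↛y)
      }
      where
      unreached? : Decidable λ w → w ∈ S × ¬ Walk G S x w
      unreached? w = w ∈? S ×-dec ¬? (walk? w)

    split : (∀ x → Decidable (Walk G S x)) → Separation S
    split walk? with any? (λ x → any? λ y → x ∈? S ×-dec y ∈? S ×-dec ¬? (walk? x y))
    ... | yes (x , y , x∈S , y∈S , x↛y) = reachability (walk? x) x∈S y∈S x↛y
    ... | no none = contradiction (nonempty , connect) disconnected
      where
      connect : ∀ x y → x ∈ S → y ∈ S → Walk G S x y
      connect x y x∈S y∈S = decidable-stable (walk? x y) λ x↛y → none (x , y , x∈S , y∈S , x↛y)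

  record Pocket (a b : Fin n) (K : Subset n) : Set where
    field
      a∉K    : a ∉ K
      b∉K    : b ∉ K
      closed : ∀ {x w} → x ∈ K → Adj G x w → w ∈ K ⊎ w ≡ a ⊎ w ≡ b
  open Pocket

  data LargePocket (v : Fin n) (K : Subset n) : Set where
    large : ∀ {p q} → Pocket v v K → p ∈ K → q ∈ K → p ≢ q → LargePocket v K

  LargePocket-boundary∉ : LargePocket v K → v ∉ K
  LargePocket-boundary∉ (large P _ _ _) = a∉K P

  side-pocket : (s : Separation (⊤ - y - e)) → Pocket y e (B s)
  side-pocket {y} {e} s = record
    { a∉K = λ y∈B → proj₁ (∈⊤-y-z⁻ (B⊆S s y∈B)) refl
    ; b∉K = λ e∈B → proj₂ (∈⊤-y-z⁻ (B⊆S s e∈B)) refl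
    ; closed = closed′
    }
    where
    closed′ : x ∈ B s → Adj G x w → w ∈ B s ⊎ w ≡ y ⊎ w ≡ e
    closed′ {w = w} x∈B xw with w ≟ y | w ≟ e
    ... | yes w≡y | _       = inj₂ (inj₁ w≡y)
    ... | no _    | yes w≡e = inj₂ (inj₂ w≡e)
    ... | no w≢y  | no w≢e  = inj₁ (adjacent-same-side (swap s) xw x∈B (∈⊤-y-z⁺ w≢y w≢e))

  pocket-without : Pocket a b K → (∀ {x} → x ∈ K → ¬ Adj G x a) → Pocket b b K
  pocket-without {a} {b} {K} P ¬adj = record { a∉K = b∉K P ; b∉K = b∉K P ; closed = closed′ }
    where
    closed′ : x ∈ K → Adj G x w → w ∈ K ⊎ w ≡ b ⊎ w ≡ b
    closed′ x∈K xw with closed P x∈K xw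
    ... | inj₁ w∈K        = inj₁ w∈K
    ... | inj₂ (inj₁ refl) = contradiction xw (¬adj x∈K)
    ... | inj₂ (inj₂ w≡b)  = inj₂ (inj₂ w≡b)

  pocket-minus : Pocket v v K → NbhdWithin y (_≡ v) → Pocket v v (K - y)
  pocket-minus {v} {K} {y} P y-pendant =
    record { a∉K = v∉K-y ; b∉K = v∉K-y ; closed = closed′ }
    where
    K-y⊆K : K - y ⊆ K
    K-y⊆K = p─q⊆p K ⁅ y ⁆
    v∉K-y : v ∉ K - y
    v∉K-y = a∉K P ∘ K-y⊆K
    closed′ : x ∈ K - y → Adj G x w → w ∈ K - y ⊎ w ≡ v ⊎ w ≡ v
    closed′ {x} {w} x∈ xw with closed P (K-y⊆K x∈) xw | w ≟ y
    ... | inj₁ w∈K | no w≢y   = inj₁ (x∈p∧x≢y⇒x∈p-y w∈K w≢y)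
    ... | inj₁ _   | yes refl = contradiction (subst (_∈ K) (y-pendant (Adj-sym xw)) (K-y⊆K x∈)) (a∉K P)
    ... | inj₂ w≡v | _        = inj₂ w≡v

  no-inner-neighbour : Pocket a b K → y ∈ K → ¬ (∃ λ w → w ∈ K × Adj G y w) →
                       NbhdWithin y (λ w → w ≡ a ⊎ w ≡ b)
  no-inner-neighbour P y∈K none yw =
    [ (λ w∈K → contradiction (_ , w∈K , yw) none) , id ] (closed P y∈K yw)

  second-member-or-pendant : Pocket v v K → z ∈ K → (∃ λ w → w ∈ K × w ≢ z) ⊎ NbhdWithin z (_≡ v)
  second-member-or-pendant {K = K} {z} P z∈K with any? (λ w → w ∈? K ×-dec ¬? (w ≟ z))
  ... | yes second = inj₁ second
  ... | no lone    = inj₂ λ zw → reduce (no-inner-neighbour P z∈K no-neighbour zw)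
    where
    no-neighbour : ¬ (∃ λ w → w ∈ K × Adj G z w)
    no-neighbour (w , w∈K , zw) = lone (w , w∈K , Adj⇒≢ zw ∘ ≡-sym)

  apex-pocket : (s : Separation (⊤ - y - a)) → Adj G y a → NbhdWithin y (λ w → w ≡ a ⊎ w ∈ B s) →
                LargePocket a (B s ∪ ⁅ y ⁆)
  apex-pocket {y} {a} s ya N⊆ =
    large pocket y∈ (x∈p∪q⁺ (inj₁ b₀∈B)) (proj₁ (∈⊤-y-z⁻ (B⊆S s b₀∈B)) ∘ ≡-sym)
    where
    b₀∈B = proj₂ (B-nonempty s)
    y∈ : y ∈ B s ∪ ⁅ y ⁆
    y∈ = x∈p∪q⁺ (inj₂ (x∈⁅x⁆ y))
    a∉ : a ∉ B s ∪ ⁅ y ⁆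
    a∉ a∈ = [ b∉K (side-pocket s) , (λ a∈⁅y⁆ → Adj⇒≢ ya (≡-sym (x∈⁅y⁆⇒x≡y y a∈⁅y⁆))) ]
              (x∈p∪q⁻ (B s) ⁅ y ⁆ a∈)
    closed′ : x ∈ B s ∪ ⁅ y ⁆ → Adj G x w → w ∈ B s ∪ ⁅ y ⁆ ⊎ w ≡ a ⊎ w ≡ a
    closed′ x∈ xw with x∈p∪q⁻ (B s) ⁅ y ⁆ x∈
    ... | inj₂ x∈⁅y⁆ with refl ← x∈⁅y⁆⇒x≡y y x∈⁅y⁆ =
      [ (inj₂ ∘ inj₁) , (λ w∈B → inj₁ (x∈p∪q⁺ (inj₁ w∈B))) ] (N⊆ xw)
    ... | inj₁ x∈B with closed (side-pocket s) x∈B xw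
    ...   | inj₁ w∈B         = inj₁ (x∈p∪q⁺ (inj₁ w∈B))
    ...   | inj₂ (inj₁ refl) = inj₁ y∈
    ...   | inj₂ (inj₂ w≡a)  = inj₂ (inj₁ w≡a)
    pocket : Pocket a a (B s ∪ ⁅ y ⁆)
    pocket = record { a∉K = a∉ ; b∉K = a∉ ; closed = closed′ }

  module SeparatingEdges
    (connected  : ∀ x y → Walk G ⊤ x y)
    (neighbour  : ∀ x → ∃ (Adj G x))
    (separation : ∀ {y e} → Adj G y e → ¬ ¬ Separation (⊤ - y - e))
    where

    pendant⇒singleton : NbhdWithin y (_≡ x) → NbhdIsSingleton G y x
    pendant⇒singleton {y} N⊆ w =
      mk⇔ N⊆ λ { refl → let (u , yu) = neighbour y in subst (Adj G y) (N⊆ yu) yu }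

    -- A vertex of B outside K cannot reach the boundary a ∈ A: every step keeps it in B ∖ K.
    far-side⊆pocket : Pocket a b K → y ∈ K → e ∈ K → (s : Separation (⊤ - y - e)) →
                      a ∈ A s → b ∈ A s → B s ⊆ K
    far-side⊆pocket {a} {b} {K} {y} {e} P y∈K e∈K s a∈A b∈A {w} w∈B =
      decidable-stable (w ∈? K) λ w∉K →
        disjoint s a∈A (proj₁ (walk-preserves Escaped escape (connected w a) (w∈B , w∉K)))
      where
      Escaped : Fin n → Set
      Escaped x = x ∈ B s × x ∉ K
      escape : ∀ {x u} → Escaped x → Adj G x u → Escaped u
      escape {x} {u} (x∈B , x∉K) xu with u ∈? K
      ... | no u∉K  = adjacent-same-side (swap s) xu x∈B (∉⇒∈⊤-y-z u∉K y∈K e∈K) , u∉K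
      ... | yes u∈K = ⊥-elim ([ x∉K , [ (λ { refl → disjoint s a∈A x∈B })
                                        , (λ { refl → disjoint s b∈A x∈B }) ] ]
                                (closed P u∈K (Adj-sym xu)))

    LowDegreeIn : Subset n → Set
    LowDegreeIn L = ∃ λ x → x ∈ L × ∃₂ λ a b → NbhdWithin x (λ w → w ≡ a ⊎ w ≡ b)

    low-degree-vertex : a ≡ b ⊎ Adj G a b → Pocket a b L → y ∈ L → ¬ ¬ LowDegreeIn L
    low-degree-vertex = go (⊂-wellFounded _)
      where
      go : Acc _⊂_ L → a ≡ b ⊎ Adj G a b → Pocket a b L → y ∈ L → ¬ ¬ LowDegreeIn L
      go {L} {a} {b} {y} (acc smaller) boundary P y∈L with any? (λ e → e ∈? L ×-dec Adj? y e)
      ... | no none = pure (y , y∈L , a , b , λ {w} → no-inner-neighbour P y∈L none {w})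
      ... | yes (e , e∈L , ye) = do
        s ← separation ye
        let (s′ , a∈A) = orient s (∉⇒∈⊤-y-z (a∉K P) y∈L e∈L)
            b∈A = [ (λ { refl → a∈A })
                  , (λ ab → adjacent-same-side s′ ab a∈A (∉⇒∈⊤-y-z (b∉K P) y∈L e∈L)) ] boundary
            B⊆L = far-side⊆pocket P y∈L e∈L s′ a∈A b∈A
            B⊂L : B s′ ⊂ L
            B⊂L = B⊆L , y , y∈L , a∉K (side-pocket s′)
        (x , x∈B , low) ← go (smaller B⊂L) (inj₂ ye) (side-pocket s′) (proj₂ (B-nonempty s′))
        pure (x , B⊆L x∈B , low)

    module InductionStep {v K} (P : Pocket v v K)
                (ih : ∀ {v′ K′} → K′ ⊂ K → LargePocket v′ K′ → ¬ ¬ SnailHorn) where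

      oriented : Adj G y e → y ∈ K → e ∈ K → ¬ ¬ Σ (Separation (⊤ - y - e)) λ s → v ∈ A s
      oriented ye y∈K e∈K = (λ s → orient s (∉⇒∈⊤-y-z (a∉K P) y∈K e∈K)) <$> separation ye

      apex : y ∈ K → a ∈ K → Adj G y a → (s : Separation (⊤ - y - a)) → v ∈ A s →
             NbhdWithin y (λ w → w ≡ a ⊎ w ∈ B s) → ¬ ¬ SnailHorn
      apex {y} {a} y∈K a∈K ya s v∈A N⊆ = ih (B∪y⊆K , a , a∈K , LargePocket-boundary∉ pocket) pocket
        where
        pocket = apex-pocket s ya N⊆
        B∪y⊆K : B s ∪ ⁅ y ⁆ ⊆ K
        B∪y⊆K x∈ = [ far-side⊆pocket P y∈K a∈K s v∈A v∈A
                   , (λ x∈⁅y⁆ → subst (_∈ K) (≡-sym (x∈⁅y⁆⇒x≡y y x∈⁅y⁆)) y∈K) ]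
                     (x∈p∪q⁻ (B s) ⁅ y ⁆ x∈)

      pendant : z ∈ K → a ∈ K → NbhdWithin z (_≡ a) → ¬ ¬ SnailHorn
      pendant z∈K a∈K N⊆ = do
        (s , v∈A) ← oriented za z∈K a∈K
        apex z∈K a∈K za s v∈A λ zw → inj₁ (N⊆ zw)
        where
        za = Equivalence.from (pendant⇒singleton N⊆ _) refl

      low-degree : y ∈ K → a ∈ K → Adj G y a → NbhdWithin y (λ w → w ≡ a ⊎ w ≡ b) → ¬ ¬ SnailHorn
      low-degree {y} {a} {b} y∈K a∈K ya N⊆ = do
        (s , v∈A) ← oriented ya y∈K a∈K
        by-side s v∈A (b ∈? B s)
        where
        by-side : (s : Separation (⊤ - y - a)) → v ∈ A s → Dec (b ∈ B s) → ¬ ¬ SnailHorn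
        by-side s v∈A (yes b∈B) = apex y∈K a∈K ya s v∈A (nbhd-toward N⊆ b∈B)
        by-side s v∈A (no b∉B)  = by-size (second-member-or-pendant P′ b₀∈B)
          where
          B⊆K = far-side⊆pocket P y∈K a∈K s v∈A v∈A
          b₀ = proj₁ (B-nonempty s)
          b₀∈B = proj₂ (B-nonempty s)
          P′ : Pocket a a (B s)
          P′ = pocket-without (side-pocket s) λ x∈B xy →
            [ (λ { refl → b∉K (side-pocket s) x∈B }) , (λ { refl → b∉B x∈B }) ] (N⊆ (Adj-sym xy))

          by-size : (∃ λ w → w ∈ B s × w ≢ b₀) ⊎ NbhdWithin b₀ (_≡ a) → ¬ ¬ SnailHorn
          by-size (inj₁ (w , w∈B , w≢b₀)) =
            ih (B⊆K , y , y∈K , a∉K (side-pocket s)) (large P′ w∈B b₀∈B w≢b₀)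
          by-size (inj₂ b₀-pendant)       = pendant (B⊆K b₀∈B) a∈K b₀-pendant

      isolated : y ∈ K → NbhdWithin y (_≡ v) → z ∈ K → z ≢ y → ¬ ¬ SnailHorn
      isolated {y} {z} y∈K y-pendant z∈K z≢y = by-size (second-member-or-pendant P′ z∈′)
        where
        P′ = pocket-minus P y-pendant
        z∈′ = x∈p∧x≢y⇒x∈p-y z∈K z≢y

        by-size : (∃ λ w → w ∈ K - y × w ≢ z) ⊎ NbhdWithin z (_≡ v) → ¬ ¬ SnailHorn
        by-size (inj₁ (w , w∈ , w≢z)) = ih (x∈p⇒p-x⊂p y∈K) (large P′ w∈ z∈′ w≢z)
        by-size (inj₂ z-pendant)      =
          pure (v , y , z , z≢y ∘ ≡-sym , pendant⇒singleton y-pendant , pendant⇒singleton z-pendant)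

      horn : ∀ {p q} → p ∈ K → q ∈ K → p ≢ q → ¬ ¬ SnailHorn
      horn {p} {q} p∈K q∈K p≢q = do
        (y , y∈K , _ , _ , N⊆) ← low-degree-vertex (inj₁ refl) P p∈K
        by-neighbour y∈K N⊆ (any? λ a → a ∈? K ×-dec Adj? y a)
        where
        another : ∀ y → ∃ λ z → z ∈ K × z ≢ y
        another y with p ≟ y
        ... | yes refl = q , q∈K , p≢q ∘ ≡-sym
        ... | no p≢y   = p , p∈K , p≢y

        by-neighbour : y ∈ K → NbhdWithin y (λ w → w ≡ a ⊎ w ≡ b) →
                       Dec (∃ λ a → a ∈ K × Adj G y a) → ¬ ¬ SnailHorn
        by-neighbour y∈K N⊆ (yes (a , a∈K , ya)) = low-degree y∈K a∈K ya (proj₂ (pivot N⊆ ya))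
        by-neighbour {y} y∈K N⊆ (no none) =
          let (z , z∈K , z≢y) = another y in
          isolated y∈K (λ yw → reduce (no-inner-neighbour P y∈K none yw)) z∈K z≢y

    large-pocket⇒snail-horn : LargePocket v K → ¬ ¬ SnailHorn
    large-pocket⇒snail-horn = go (⊂-wellFounded _)
      where
      go : Acc _⊂_ K → LargePocket v K → ¬ ¬ SnailHorn
      go (acc smaller) (large P p∈K q∈K p≢q) =
        InductionStep.horn P (λ K′⊂K → go (smaller K′⊂K)) p∈K q∈K p≢q

    low-degree⇒large-pocket : Adj G y a → NbhdWithin y (λ w → w ≡ a ⊎ w ≡ b) →
                              Separation (⊤ - y - a) → ∃ (LargePocket a)
    low-degree⇒large-pocket {y} {a} {b} ya N⊆ s with b ∈? B s
    ... | yes b∈B = _ , apex-pocket s ya (nbhd-toward N⊆ b∈B)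
    ... | no b∉B  = _ , apex-pocket (swap s) ya toward-A
      where
      toward-A : NbhdWithin y (λ w → w ≡ a ⊎ w ∈ A s)
      toward-A {w} yw with w ≟ a
      ... | yes w≡a = inj₁ w≡a
      ... | no w≢a  = inj₂ ([ id , (λ w∈B → ⊥-elim (b∉B (subst (_∈ B s) (w≡b (N⊆ yw)) w∈B))) ]
                              (cover s (∈⊤-y-z⁺ (Adj⇒≢ yw ∘ ≡-sym) w≢a)))
        where
        w≡b : w ≡ a ⊎ w ≡ b → w ≡ b
        w≡b = [ (λ w≡a → contradiction w≡a w≢a) , id ]

    snail-horn : Fin n → ¬ ¬ SnailHorn
    snail-horn u = do
      let (u′ , uu′) = neighbour u
      s ← separation uu′
      (y , _ , _ , _ , N⊆) ← low-degree-vertex (inj₂ uu′) (side-pocket s) (proj₂ (B-nonempty s))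
      let (a , ya) = neighbour y
      s′ ← separation ya
      large-pocket⇒snail-horn (proj₂ (low-degree⇒large-pocket ya (proj₂ (pivot N⊆ ya)) s′))

corollary2p3 : ∀ n (G : Graph n) → 2 ≤ n → DeficiencyCritical G →
    ∃[ x ] ∃[ y ] ∃[ z ]
      (y ≢ z × NbhdIsSingleton G y x × NbhdIsSingleton G z x)
corollary2p3 (suc (suc m)) G (s≤s (s≤s z≤n)) critical =
  decidable-stable (snail-horn? G) (SeparatingEdges.snail-horn G connected neighbour separation zero)
  where
  connected : ∀ x y → Walk G ⊤ x y
  connected x y = proj₂ (proj₁ critical) x y ∈⊤ ∈⊤

  neighbour : ∀ x → ∃ (Adj G x)
  neighbour zero    = first-edge G (connected zero (suc zero)) λ ()
  neighbour (suc x) = first-edge G (connected (suc x) zero) λ ()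

  separation : ∀ {y e} → Adj G y e → ¬ ¬ Separation G (⊤ - y - e)
  separation ye = ¬connected⇒separation G (critical⇒deletion-nonempty G critical ye)
                                          (critical⇒deletion-disconnected G critical ye)
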